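{- Let $\langle A;\cdot,0\rangle$ be a bounded quasi-implication algebra and let $\mathfrak{F}(A)$ be the set of its proper filters. Define $\perp^G_A\subseteq\mathfrak{F}(A)\times\mathfrak{F}(A)$ by $\alpha\perp^G_A\beta$ iff there exists $x\in A$ with $x\in\alpha$ and $x\cdot 0\in\beta$. Then $\perp^G_A$ is irreflexive and symmetric, i.e. $\langle\mathfrak{F}(A);\perp^G_A\rangle$ is an orthoframe.
   Context: A quasi-implication algebra is a magma $\langle A;\cdot\rangle$ satisfying, for all $x,y,z\in A$: (1) $(x\cdot y)\cdot x=x$; (2) $(x\cdot y)\cdot(x\cdot z)=(y\cdot x)\cdot(y\cdot z)$; (3) $((x\cdot y)\cdot(y\cdot x))\cdot x=((y\cdot x)\cdot(x\cdot y))\cdot y$. In any quasi-implication algebra $x\cdot x=y\cdot y$ for all $x,y$, and $1$ denotes this common element. A bounded quasi-implication algebra is a quasi-implication algebra with a distinguished element $0$ such that $0\cdot x=1$ for all $x\in A$. A filter of a bounded quasi-implication algebra $A$ is a non-empty subset $\alpha\subseteq A$ such that (i) if $x\in\alpha$ and $x\cdot y=1$ then $y\in\alpha$; (ii) if $x,y\in\alpha$ then $((x\cdot y)\cdot(x\cdot 0))\cdot 0\in\alpha$. A filter is proper if $0\notin\alpha$. An orthoframe is a set equipped with an irreflexive symmetric binary relation. -}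

module Defs where

open import Level using (Level; _⊔_; suc)
open import Data.Product using (Σ; ∃; _×_; _,_)
open import Relation.Binary.PropositionalEquality using (_≡_)
open import Relation.Nullary using (¬_)

record IsQuasiImplicationAlgebra {a} {A : Set a} (_·_ : A → A → A) : Set a where
  field
    absorb : ∀ x y → (x · y) · x ≡ x
    exch   : ∀ x y z → (x · y) · (x · z) ≡ (y · x) · (y · z)
    qcomm  : ∀ x y → ((x · y) · (y · x)) · x ≡ ((y · x) · (x · y)) · y

record BoundedQIA (a : Level) : Set (suc a) where
  field
    Carrier : Set a
    _·_     : Carrier → Carrier → Carrier
    𝟘       : Carrier
    isQIA   : IsQuasiImplicationAlgebra _·_
  -- 1 is the common value of x · x; we take 0 · 0 as the representative
  𝟙 : Carrier
  𝟙 = 𝟘 · 𝟘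
  field
    bounded : ∀ x → 𝟘 · x ≡ 𝟙
  open IsQuasiImplicationAlgebra isQIA public

module _ {a : Level} (A : BoundedQIA a) where
  open BoundedQIA A

  Subset : (ℓ : Level) → Set (a ⊔ suc ℓ)
  Subset ℓ = Carrier → Set ℓ

  record IsFilter {ℓ} (α : Subset ℓ) : Set (a ⊔ ℓ) where
    field
      nonempty : ∃ λ x → α x
      upward   : ∀ {x y} → α x → x · y ≡ 𝟙 → α y
      closed   : ∀ {x y} → α x → α y → α (((x · y) · (x · 𝟘)) · 𝟘)

  record IsProperFilter {ℓ} (α : Subset ℓ) : Set (a ⊔ ℓ) where
    field
      isFilter : IsFilter α
      proper   : ¬ α 𝟘

  ProperFilter : (ℓ : Level) → Set (a ⊔ suc ℓ)
  ProperFilter ℓ = Σ (Subset ℓ) IsProperFilter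

  _⊥ᴳ_ : ∀ {ℓ} → ProperFilter ℓ → ProperFilter ℓ → Set (a ⊔ ℓ)
  (α , _) ⊥ᴳ (β , _) = ∃ λ x → α x × β (x · 𝟘)

record IsOrthoframe {a r} (X : Set a) (_⊥_ : X → X → Set r) : Set (a ⊔ r) where
  field
    irrefl : ∀ x → ¬ (x ⊥ x)
    sym    : ∀ {x y} → x ⊥ y → y ⊥ x

-- Write ∼x for x · 0. The filter term for x and ∼x is ((x · ∼x) · ∼x) · 0, and the absorption
-- law collapses x · ∼x to ∼x, so the term is (∼x · ∼x) · 0 = 1 · 0 = 0; hence no proper filter
-- contains both x and ∼x. Symmetry rests on x · ∼∼x = 1: if x ∈ α and ∼x ∈ β, then ∼x ∈ β and
-- ∼∼x lies in α by upward closure.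
module Submission where

open import Defs
open import Level using (Level)
open import Data.Product using (_×_; _,_)
open import Relation.Binary.PropositionalEquality using (_≡_; sym; trans; cong; cong₂; subst; module ≡-Reasoning)
open import Relation.Nullary using (¬_)

module BoundedQIAProperties {a : Level} (A : BoundedQIA a) where
  open BoundedQIA A
  open ≡-Reasoning

  infix 25 ∼_
  ∼_ : Carrier → Carrier
  ∼ x = x · 𝟘

  𝟙·𝟘≡𝟘 : 𝟙 · 𝟘 ≡ 𝟘
  𝟙·𝟘≡𝟘 = trans (cong (_· 𝟘) (sym (bounded 𝟘))) (absorb 𝟘 𝟘)

  𝟙·𝟙≡𝟙 : 𝟙 · 𝟙 ≡ 𝟙
  𝟙·𝟙≡𝟙 = begin
    𝟙 · 𝟙                  ≡⟨ cong₂ _·_ (sym (bounded 𝟙)) (sym (bounded 𝟘)) ⟩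
    (𝟘 · 𝟙) · (𝟘 · 𝟘)      ≡⟨ exch 𝟘 𝟙 𝟘 ⟩
    (𝟙 · 𝟘) · (𝟙 · 𝟘)      ≡⟨ cong (_· (𝟙 · 𝟘)) 𝟙·𝟘≡𝟘 ⟩
    𝟘 · (𝟙 · 𝟘)            ≡⟨ bounded _ ⟩
    𝟙                      ∎

  x·∼x≡∼x : ∀ x → x · ∼ x ≡ ∼ x
  x·∼x≡∼x x = begin
    x · ∼ x                ≡⟨ cong (_· ∼ x) (sym (absorb x 𝟘)) ⟩
    (∼ x · x) · ∼ x        ≡⟨ absorb (∼ x) x ⟩
    ∼ x                    ∎

  ∼x·∼x≡𝟙 : ∀ x → ∼ x · ∼ x ≡ 𝟙
  ∼x·∼x≡𝟙 x = begin
    ∼ x · ∼ x              ≡⟨ exch x 𝟘 𝟘 ⟩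
    (𝟘 · x) · (𝟘 · 𝟘)      ≡⟨ cong₂ _·_ (bounded x) (bounded 𝟘) ⟩
    𝟙 · 𝟙                  ≡⟨ 𝟙·𝟙≡𝟙 ⟩
    𝟙                      ∎

  x·∼∼x≡𝟙 : ∀ x → x · ∼ ∼ x ≡ 𝟙
  x·∼∼x≡𝟙 x = begin
    x · ∼ ∼ x                      ≡⟨ cong (_· ∼ ∼ x) (sym (absorb x 𝟘)) ⟩
    (∼ x · x) · ∼ ∼ x              ≡⟨ sym (exch x (∼ x) 𝟘) ⟩
    (x · ∼ x) · ∼ x                ≡⟨ cong (_· ∼ x) (x·∼x≡∼x x) ⟩
    ∼ x · ∼ x                      ≡⟨ ∼x·∼x≡𝟙 x ⟩
    𝟙                              ∎

  ∼[[x·∼x]·∼x]≡𝟘 : ∀ x → ∼ ((x · ∼ x) · ∼ x) ≡ 𝟘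
  ∼[[x·∼x]·∼x]≡𝟘 x = begin
    ∼ ((x · ∼ x) · ∼ x)            ≡⟨ cong (λ t → (t · ∼ x) · 𝟘) (x·∼x≡∼x x) ⟩
    (∼ x · ∼ x) · 𝟘                ≡⟨ cong (_· 𝟘) (∼x·∼x≡𝟙 x) ⟩
    𝟙 · 𝟘                          ≡⟨ 𝟙·𝟘≡𝟘 ⟩
    𝟘                              ∎

  module _ {ℓ : Level} {α : Subset A ℓ} (α-proper : IsProperFilter A α) where
    open IsProperFilter α-proper
    open IsFilter isFilter

    proper⇒¬[x∈α×∼x∈α] : ∀ {x} → ¬ (α x × α (∼ x))
    proper⇒¬[x∈α×∼x∈α] {x} (x∈α , ∼x∈α) =
      proper (subst α (∼[[x·∼x]·∼x]≡𝟘 x) (closed x∈α ∼x∈α))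

    x∈α⇒∼∼x∈α : ∀ {x} → α x → α (∼ ∼ x)
    x∈α⇒∼∼x∈α {x} x∈α = upward x∈α (x·∼∼x≡𝟙 x)

proposition3p7 : ∀ {a ℓ : Level} (A : BoundedQIA a) →
    IsOrthoframe (ProperFilter A ℓ) (_⊥ᴳ_ A)
proposition3p7 A = record
  { irrefl = λ { (α , α-proper) (x , x∈α , ∼x∈α) → proper⇒¬[x∈α×∼x∈α] α-proper (x∈α , ∼x∈α) }
  ; sym    = λ { {α , α-proper} {β , _} (x , x∈α , ∼x∈β) → ∼ x , ∼x∈β , x∈α⇒∼∼x∈α α-proper x∈α }
  }
  where open BoundedQIAProperties A
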